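{- Let $G=(V_G=[n],E_G)$ be an $n$-vertex graph and let $H=(A=\{u_1,\dots,u_n\},B=\{v_1,\dots,v_n\},E_H)$ be a bipartite graph with $n$ vertices on each side. Let $G\boxminus H=(A,B,E_{G\boxminus H})$ be the bipartite graph in which (1) for every $i\ne j$ in $[n]$, $(u_i,v_j)\in E_{G\boxminus H}$ if and only if $(u_i,v_j)\in E_H$ and $\{i,j\}\in E_G$, and (2) for every $i\in[n]$, $(u_i,v_i)\in E_{G\boxminus H}$. Then $\nu_c(G\boxminus H)\le \omega(G)+3\nu_c(H)$, where $\omega(G)$ is the clique number of $G$. Furthermore, if $H$ is a bipartite half-cover of $K_n$, then $\omega(G)\le \nu_c(G\boxminus H)$.
   Context: A connected matching in a graph $F$ is a matching $M$ (set of vertex-disjoint edges) such that every two distinct edges of $M$ are connected by an edge of $F$; $\nu_c(F)$ is the maximum size of a connected matching in $F$. A bipartite graph $H=(\{u_1,\dots,u_n\},\{v_1,\dots,v_n\},E_H)$ is a bipartite half-cover of $K_n$ if for every $i\ne j$, $(u_i,v_j)\in E_H$ or $(u_j,v_i)\in E_H$, and for every $i$, $(u_i,v_i)\notin E_H$. -}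

module Defs where

open import Data.Nat using (ℕ; _≤_)
open import Data.Fin using (Fin)
open import Data.Product using (_×_; _,_; proj₁; proj₂; ∃-syntax)
open import Data.Sum using (_⊎_)
open import Data.List using (List; length)
open import Data.List.Relation.Unary.All using (All)
open import Data.List.Relation.Unary.AllPairs using (AllPairs)
open import Relation.Binary.PropositionalEquality using (_≡_; _≢_)
open import Relation.Nullary using (¬_)

record Graph (n : ℕ) : Set₁ where
  field
    Adj     : Fin n → Fin n → Set
    sym     : ∀ {i j} → Adj i j → Adj j i
    irrefl  : ∀ i → ¬ Adj i i
open Graph public

-- A bipartite graph with sides A = {u_1..u_n}, B = {v_1..v_n}:
-- BipGraph n relates i to j iff (u_i , v_j) is an edge.
BipGraph : ℕ → Set₁
BipGraph n = Fin n → Fin n → Set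

IsClique : ∀ {n} → Graph n → List (Fin n) → Set
IsClique G K = AllPairs (Adj G) K

IsCliqueNumber : ∀ {n} → Graph n → ℕ → Set
IsCliqueNumber G k =
  (∃[ K ] (IsClique G K × length K ≡ k)) ×
  (∀ K → IsClique G K → length K ≤ k)

IsMatching : ∀ {n} → BipGraph n → List (Fin n × Fin n) → Set
IsMatching F M =
  All (λ e → F (proj₁ e) (proj₂ e)) M ×
  AllPairs (λ e e' → (proj₁ e ≢ proj₁ e') × (proj₂ e ≢ proj₂ e')) M

-- Two edges (u_i,v_j), (u_i',v_j') are joined by an edge of a bipartite F
-- iff (u_i , v_j') ∈ F or (u_i' , v_j) ∈ F.
IsConnectedMatching : ∀ {n} → BipGraph n → List (Fin n × Fin n) → Set
IsConnectedMatching F M =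
  IsMatching F M ×
  AllPairs (λ e e' → F (proj₁ e) (proj₂ e') ⊎ F (proj₁ e') (proj₂ e)) M

IsNuC : ∀ {n} → BipGraph n → ℕ → Set
IsNuC F k =
  (∃[ M ] (IsConnectedMatching F M × length M ≡ k)) ×
  (∀ M → IsConnectedMatching F M → length M ≤ k)

_⊟_ : ∀ {n} → Graph n → BipGraph n → BipGraph n
(G ⊟ H) i j = (i ≡ j) ⊎ ((i ≢ j) × H i j × Adj G i j)

IsHalfCover : ∀ {n} → BipGraph n → Set
IsHalfCover {n} H =
  (∀ (i j : Fin n) → i ≢ j → H i j ⊎ H j i) × (∀ (i : Fin n) → ¬ H i i)

-- The loops (u_i , v_i) of a connected matching of G ⊟ H can only be joined through
-- G-edges, so their indices form a clique of G. Two non-loop edges e, e' are joined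
-- either by an edge of H or by a loop, and the latter needs a vertex of e to share
-- its index with the opposite vertex of e'; in a matching each edge is in that
-- position towards at most two others, so greedily keeping an edge and discarding
-- those two leaves a third of the non-loop edges, pairwise joined in H.
-- Conversely, when H is a half-cover, the loops over a clique of G are pairwise joined.
module Submission where

open import Defs hiding (sym)
open import Data.Nat using (ℕ; suc; _+_; _*_; _≤_; z≤n; s≤s)
open import Data.Nat.Properties
  using (≤-refl; ≤-trans; +-suc; *-suc; +-mono-≤; *-monoʳ-≤; module ≤-Reasoning)
open import Data.Fin using (Fin)
open import Data.Fin.Properties using (_≟_)
open import Data.Product using (_×_; _,_; proj₁; proj₂; ∃-syntax)
open import Data.Sum using (_⊎_; inj₁; inj₂)
open import Data.List using (List; []; _∷_; length; map; filter)
open import Data.List.Properties using (length-map; length-filter; filter-all)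
open import Data.List.Relation.Unary.All as All using (All; []; _∷_)
open import Data.List.Relation.Unary.All.Properties using (all-filter)
import Data.List.Relation.Unary.All.Properties as All
open import Data.List.Relation.Unary.AllPairs as AllPairs using (AllPairs; []; _∷_)
import Data.List.Relation.Unary.AllPairs.Properties as AllPairs
open import Data.List.Relation.Binary.Sublist.Propositional using (_⊆_; []; _∷_; _∷ʳ_; ⊆-trans)
open import Data.List.Relation.Binary.Sublist.Propositional.Properties
  using (All-resp-⊆; filter-⊆)
open import Data.Empty using (⊥-elim)
open import Relation.Binary.Core using (Rel)
open import Relation.Binary.Definitions using (DecidableEquality)
open import Relation.Binary.PropositionalEquality
  using (_≡_; _≢_; refl; sym; trans; cong; subst; ≢-sym)
open import Relation.Nullary using (yes; no; ¬?)
open import Relation.Unary using (Pred; Decidable; ∁)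
open import Relation.Unary.Properties using (∁?)

module _ {a r} {A : Set a} {R : Rel A r} where

  AllPairs-resp-⊆ : ∀ {xs ys} → xs ⊆ ys → AllPairs R ys → AllPairs R xs
  AllPairs-resp-⊆ []          []          = []
  AllPairs-resp-⊆ (_ ∷ʳ xs⊆ys) (_ ∷ ys!)   = AllPairs-resp-⊆ xs⊆ys ys!
  AllPairs-resp-⊆ (refl ∷ xs⊆ys) (y∉ ∷ ys!) = All-resp-⊆ xs⊆ys y∉ ∷ AllPairs-resp-⊆ xs⊆ys ys!

module _ {a p} {A : Set a} {P : Pred A p} (P? : Decidable P) where

  length-filter+length-filter-∁ : ∀ xs →
    length (filter P? xs) + length (filter (∁? P?) xs) ≡ length xs
  length-filter+length-filter-∁ [] = refl
  length-filter+length-filter-∁ (x ∷ xs) with P? x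
  ... | yes _ = cong suc (length-filter+length-filter-∁ xs)
  ... | no _  = trans (+-suc _ _) (cong suc (length-filter+length-filter-∁ xs))

module _ {a b} {A : Set a} {B : Set b} (_≟ᴮ_ : DecidableEquality B) (f : A → B) (y : B) where

  length-≤-suc-filter-≢ : ∀ {xs} → AllPairs (λ x x′ → f x ≢ f x′) xs →
    length xs ≤ suc (length (filter (λ x → ¬? (f x ≟ᴮ y)) xs))
  length-≤-suc-filter-≢ [] = z≤n
  length-≤-suc-filter-≢ {x ∷ xs} (fx∉ ∷ xs!) with f x ≟ᴮ y
  ... | yes refl rewrite filter-all (λ x′ → ¬? (f x′ ≟ᴮ y)) (All.map ≢-sym fx∉) = ≤-refl
  ... | no _ = s≤s (length-≤-suc-filter-≢ xs!)

module EdgeLists {v} {V : Set v} (_≟ⱽ_ : DecidableEquality V) where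

  loop : V → V × V
  loop i = i , i

  IsLoop : Pred (V × V) v
  IsLoop e = proj₁ e ≡ proj₂ e

  isLoop? : Decidable IsLoop
  isLoop? e = proj₁ e ≟ⱽ proj₂ e

  VertexDisjoint : Rel (V × V) v
  VertexDisjoint e e′ = proj₁ e ≢ proj₁ e′ × proj₂ e ≢ proj₂ e′

  -- Neither of the two pairs that could join e and e′ in a bipartite graph is a loop.
  NoCrossLoop : Rel (V × V) v
  NoCrossLoop e e′ = proj₁ e ≢ proj₂ e′ × proj₁ e′ ≢ proj₂ e

  map-loop-proj₁ : ∀ {D} → All IsLoop D → map loop (map proj₁ D) ≡ D
  map-loop-proj₁ []                               = refl
  map-loop-proj₁ {(i , .i) ∷ D} (refl ∷ D-loops) = cong (loop i ∷_) (map-loop-proj₁ D-loops)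

  module _ (e : V × V) where

    private
      vNotU? : Decidable (λ (x : V × V) → proj₂ x ≢ proj₁ e)
      vNotU? x = ¬? (proj₂ x ≟ⱽ proj₁ e)

      uNotV? : Decidable (λ (x : V × V) → proj₁ x ≢ proj₂ e)
      uNotV? x = ¬? (proj₁ x ≟ⱽ proj₂ e)

    dropCrossLoops : List (V × V) → List (V × V)
    dropCrossLoops T = filter uNotV? (filter vNotU? T)

    dropCrossLoops-⊆ : ∀ T → dropCrossLoops T ⊆ T
    dropCrossLoops-⊆ T = ⊆-trans (filter-⊆ uNotV? (filter vNotU? T)) (filter-⊆ vNotU? T)

    length-dropCrossLoops : ∀ T → length (dropCrossLoops T) ≤ length T
    length-dropCrossLoops T = ≤-trans (length-filter uNotV? (filter vNotU? T)) (length-filter vNotU? T)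

    dropCrossLoops-noCrossLoop : ∀ T → All (NoCrossLoop e) (dropCrossLoops T)
    dropCrossLoops-noCrossLoop T = All.zipWith (λ (ne₂ , ne₁) → ≢-sym ne₂ , ne₁)
      (All.filter⁺ uNotV? (all-filter vNotU? T) , all-filter uNotV? (filter vNotU? T))

    module _ {T} (T! : AllPairs VertexDisjoint T) where

      dropCrossLoops-disjoint : AllPairs VertexDisjoint (dropCrossLoops T)
      dropCrossLoops-disjoint = AllPairs.filter⁺ uNotV? (AllPairs.filter⁺ vNotU? T!)

      length-≤-2+dropCrossLoops : length T ≤ 2 + length (dropCrossLoops T)
      length-≤-2+dropCrossLoops = ≤-trans
        (length-≤-suc-filter-≢ _≟ⱽ_ proj₂ (proj₁ e) (AllPairs.map proj₂ T!))
        (s≤s (length-≤-suc-filter-≢ _≟ⱽ_ proj₁ (proj₂ e)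
          (AllPairs.map proj₁ (AllPairs.filter⁺ vNotU? T!))))

  noCrossLoop-sublist : ∀ {M} → AllPairs VertexDisjoint M →
    ∃[ S ] (S ⊆ M × AllPairs NoCrossLoop S × length M ≤ 3 * length S)
  noCrossLoop-sublist {M} = greedy (length M) ≤-refl
    where
    greedy : ∀ k {M} → length M ≤ k → AllPairs VertexDisjoint M →
      ∃[ S ] (S ⊆ M × AllPairs NoCrossLoop S × length M ≤ 3 * length S)
    greedy _       {[]}    _          _ = [] , [] , [] , z≤n
    greedy (suc k) {e ∷ T} (s≤s |T|≤k) (_ ∷ T!)
      with greedy k (≤-trans (length-dropCrossLoops e T) |T|≤k) (dropCrossLoops-disjoint e T!)
    ... | S , S⊆T′ , S! , |T′|≤3|S| =
      e ∷ S , refl ∷ ⊆-trans S⊆T′ (dropCrossLoops-⊆ e T) ,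
      All-resp-⊆ S⊆T′ (dropCrossLoops-noCrossLoop e T) ∷ S! ,
      (begin
        suc (length T)                          ≤⟨ s≤s (length-≤-2+dropCrossLoops e T!) ⟩
        3 + length (dropCrossLoops e T)         ≤⟨ +-mono-≤ (≤-refl {3}) |T′|≤3|S| ⟩
        3 + 3 * length S                        ≡⟨ sym (*-suc 3 (length S)) ⟩
        3 * suc (length S)                      ∎)
      where open ≤-Reasoning

Joined : ∀ {n} → BipGraph n → Rel (Fin n × Fin n) _
Joined F e e′ = F (proj₁ e) (proj₂ e′) ⊎ F (proj₁ e′) (proj₂ e)

connectedMatching-filter⁺ : ∀ {n} {F : BipGraph n} {p} {P : Pred (Fin n × Fin n) p} (P? : Decidable P) →
  ∀ {M} → IsConnectedMatching F M → IsConnectedMatching F (filter P? M)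
connectedMatching-filter⁺ P? ((edges , disjoint) , joined) =
  (All.filter⁺ P? edges , AllPairs.filter⁺ P? disjoint) , AllPairs.filter⁺ P? joined

module _ {n} (G : Graph n) (H : BipGraph n) where

  open EdgeLists (_≟_ {n})

  Adj⇒≢ : ∀ {i j} → Adj G i j → i ≢ j
  Adj⇒≢ {i} adj refl = irrefl G i adj

  ⊟-nonLoop⇒H : ∀ {i j} → i ≢ j → (G ⊟ H) i j → H i j
  ⊟-nonLoop⇒H i≢j (inj₁ i≡j)         = ⊥-elim (i≢j i≡j)
  ⊟-nonLoop⇒H _   (inj₂ (_ , h , _)) = h

  Joined-⊟⇒Joined : ∀ {e e′} → NoCrossLoop e e′ → Joined (G ⊟ H) e e′ → Joined H e e′
  Joined-⊟⇒Joined (ne , _) (inj₁ g) = inj₁ (⊟-nonLoop⇒H ne g)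
  Joined-⊟⇒Joined (_ , ne) (inj₂ g) = inj₂ (⊟-nonLoop⇒H ne g)

  Joined-⊟-loops⇒Adj : ∀ {i j} → i ≢ j → Joined (G ⊟ H) (loop i) (loop j) → Adj G i j
  Joined-⊟-loops⇒Adj i≢j (inj₁ (inj₁ i≡j))         = ⊥-elim (i≢j i≡j)
  Joined-⊟-loops⇒Adj _   (inj₁ (inj₂ (_ , _ , adj))) = adj
  Joined-⊟-loops⇒Adj i≢j (inj₂ (inj₁ j≡i))         = ⊥-elim (i≢j (sym j≡i))
  Joined-⊟-loops⇒Adj _   (inj₂ (inj₂ (_ , _ , adj))) = Graph.sym G adj

  Adj⇒Joined-⊟-loops : IsHalfCover H → ∀ {i j} → Adj G i j → Joined (G ⊟ H) (loop i) (loop j)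
  Adj⇒Joined-⊟-loops (cover , _) {i} {j} adj with cover i j (Adj⇒≢ adj)
  ... | inj₁ h = inj₁ (inj₂ (Adj⇒≢ adj , h , adj))
  ... | inj₂ h = inj₂ (inj₂ (≢-sym (Adj⇒≢ adj) , h , Graph.sym G adj))

  loops-clique : ∀ {K} → AllPairs (Joined (G ⊟ H)) (map loop K) →
    AllPairs VertexDisjoint (map loop K) → IsClique G K
  loops-clique joined disjoint = AllPairs.zipWith (λ (j , d) → Joined-⊟-loops⇒Adj (proj₁ d) j)
    (AllPairs.map⁻ joined , AllPairs.map⁻ disjoint)

  clique-loops-connectedMatching : IsHalfCover H → ∀ {K} → IsClique G K →
    IsConnectedMatching (G ⊟ H) (map loop K)
  clique-loops-connectedMatching hc clique =
    ( All.map⁺ (All.universal (λ _ → inj₁ refl) _)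
    , AllPairs.map⁺ (AllPairs.map (λ adj → Adj⇒≢ adj , Adj⇒≢ adj) clique))
    , AllPairs.map⁺ (AllPairs.map (Adj⇒Joined-⊟-loops hc) clique)

  loopMatching-length-≤ : ∀ {D w} → All IsLoop D → IsConnectedMatching (G ⊟ H) D →
    IsCliqueNumber G w → length D ≤ w
  loopMatching-length-≤ {D} {w} D-loops ((_ , disjoint) , joined) (_ , ω-max) =
    subst (_≤ w) (length-map proj₁ D) (ω-max (map proj₁ D) (loops-clique
      (subst (AllPairs (Joined (G ⊟ H))) D≡loops joined)
      (subst (AllPairs VertexDisjoint) D≡loops disjoint)))
    where
    D≡loops : D ≡ map loop (map proj₁ D)
    D≡loops = sym (map-loop-proj₁ D-loops)

  nonLoopMatching-length-≤ : ∀ {N c} → All (∁ IsLoop) N → IsConnectedMatching (G ⊟ H) N →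
    IsNuC H c → length N ≤ 3 * c
  nonLoopMatching-length-≤ N-nonLoops ((edges , disjoint) , joined) (_ , ν-max)
    with noCrossLoop-sublist disjoint
  ... | S , S⊆N , S! , |N|≤3|S| = ≤-trans |N|≤3|S| (*-monoʳ-≤ 3 (ν-max S S-connected))
    where
    S-connected : IsConnectedMatching H S
    S-connected =
      ( All-resp-⊆ S⊆N (All.zipWith (λ (ne , g) → ⊟-nonLoop⇒H ne g) (N-nonLoops , edges))
      , AllPairs-resp-⊆ S⊆N disjoint)
      , AllPairs.zipWith (λ (nc , j) → Joined-⊟⇒Joined nc j) (S! , AllPairs-resp-⊆ S⊆N joined)

  ⊟-connectedMatching-length-≤ : ∀ {M w c} → IsConnectedMatching (G ⊟ H) M →
    IsCliqueNumber G w → IsNuC H c → length M ≤ w + 3 * c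
  ⊟-connectedMatching-length-≤ {M} {w} {c} M-connected ω ν = begin
    length M                                                  ≡⟨ sym (length-filter+length-filter-∁ isLoop? M) ⟩
    length (filter isLoop? M) + length (filter (∁? isLoop?) M) ≤⟨ +-mono-≤ loops≤w nonLoops≤3c ⟩
    w + 3 * c                                                 ∎
    where
    open ≤-Reasoning
    loops≤w : length (filter isLoop? M) ≤ w
    loops≤w = loopMatching-length-≤ (all-filter isLoop? M) (connectedMatching-filter⁺ isLoop? M-connected) ω
    nonLoops≤3c : length (filter (∁? isLoop?) M) ≤ 3 * c
    nonLoops≤3c = nonLoopMatching-length-≤ (all-filter (∁? isLoop?) M)
      (connectedMatching-filter⁺ (∁? isLoop?) M-connected) ν

  clique-length-≤-⊟-matching : IsHalfCover H → ∀ {K a} → IsClique G K →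
    IsNuC (G ⊟ H) a → length K ≤ a
  clique-length-≤-⊟-matching hc {K} {a} clique (_ , ν-max) =
    subst (_≤ a) (length-map loop K) (ν-max (map loop K) (clique-loops-connectedMatching hc clique))

mainTheorem3 : ∀ {n} (G : Graph n) (H : BipGraph n) →
    (∀ (a w c : ℕ) → IsNuC (G ⊟ H) a → IsCliqueNumber G w → IsNuC H c →
      a ≤ w + 3 * c)
    × (IsHalfCover H → ∀ (a w : ℕ) → IsNuC (G ⊟ H) a → IsCliqueNumber G w →
      w ≤ a)
mainTheorem3 G H =
  (λ a w c ((M , M-connected , |M|≡a) , _) ω ν →
     subst (_≤ w + 3 * c) |M|≡a (⊟-connectedMatching-length-≤ G H M-connected ω ν))
  , λ hc a w ν ((K , clique , |K|≡w) , _) →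
     subst (_≤ a) |K|≡w (clique-length-≤-⊟-matching G H hc clique ν)
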